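{- The class of subgraphs of the square grid is $(6,1)$-disjointness-expressing.
   Context: All graphs are finite, simple and connected. The square grid is the infinite graph on $\mathbb{Z}^2$ where two points are adjacent iff at Euclidean distance $1$; the class consists of graphs isomorphic to finite (connected) subgraphs of it. $N[S]$ denotes the closed neighbourhood of a vertex set $S$. A class $\mathcal{C}$ is $(s,\kappa)$-disjointness-expressing if for some constant $\alpha>0$, for every positive integer $N$ and every $X\subseteq\{1,\dots,N\}$ one can define graphs $L(X)$ and $R(X)$, each containing a labelled set $S$ of special vertices, such that for all $A,B\subseteq\{1,\dots,N\}$: (i) the graph $g(L(A),R(B))$ obtained by identifying each vertex of $S$ in $L(A)$ with the corresponding vertex of $S$ in $R(B)$ is connected and has at most $\alpha N^{1/\kappa}$ vertices; (ii) the subgraph of $g(L(A),R(B))$ induced by $N[S]$ is independent of $A$ and $B$ (for all $A,A',B,B'$ there is an isomorphism between the corresponding induced subgraphs that is the identity on $S$) and has at most $s$ vertices; (iii) $g(L(A),R(B))\in\mathcal{C}$ if and only if $A\cap B=\emptyset$. -}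

module Defs where

open import Level using (0ℓ)
open import Data.Nat as ℕ using (ℕ; _≤_; _^_)
open import Data.Integer as ℤ using (ℤ; +_)
open import Data.Fin using (Fin)
open import Data.Fin.Subset using (Subset; _∩_; Empty)
open import Data.Product using (Σ; ∃; _×_; _,_)
open import Data.Sum using (_⊎_; inj₁; inj₂)
open import Data.Empty using (⊥)
open import Relation.Nullary using (¬_)
open import Relation.Binary.PropositionalEquality using (_≡_)
open import Function.Bundles using (_⇔_)

-- Simple (undirected, loopless) graphs on a vertex type V.
-- Finiteness is not built in; it is implied where needed by vertex
-- count bounds (an injection into some Fin m).

record GraphOn (V : Set) : Set₁ where
  field
    E     : V → V → Set
    E-sym : ∀ {u v} → E u v → E v u
    E-irr : ∀ {v} → ¬ E v v
open GraphOn public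

AtMost : ℕ → (V : Set) → Set
AtMost m V = Σ (V → Fin m) λ f → ∀ {u v} → f u ≡ f v → u ≡ v

data Reach {V : Set} (G : GraphOn V) : V → V → Set where
  here : ∀ {v} → Reach G v v
  step : ∀ {u w v} → E G u w → Reach G w v → Reach G u v

Connected : {V : Set} → GraphOn V → Set
Connected {V} G = ∀ (u v : V) → Reach G u v

-- A class of graphs (closed under isomorphism in the intended use).
Class : Set₂
Class = {V : Set} → GraphOn V → Set₁

Point : Set
Point = ℤ × ℤ

GridAdj : Point → Point → Set
GridAdj (x₁ , y₁) (x₂ , y₂) =
  (x₁ ℤ.- x₂) ℤ.* (x₁ ℤ.- x₂) ℤ.+ (y₁ ℤ.- y₂) ℤ.* (y₁ ℤ.- y₂) ≡ + 1

record GridSubgraph : Set₁ where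
  field
    n       : ℕ
    pos     : Fin n → Point
    pos-inj : ∀ {i j} → pos i ≡ pos j → i ≡ j
    F       : Fin n → Fin n → Set
    F-sym   : ∀ {i j} → F i j → F j i
    F-grid  : ∀ {i j} → F i j → GridAdj (pos i) (pos j)
open GridSubgraph public

record Iso {V W : Set} (G : GraphOn V) (F' : W → W → Set) : Set where
  field
    to      : V → W
    from    : W → V
    from-to : ∀ v → from (to v) ≡ v
    to-from : ∀ w → to (from w) ≡ w
    edges   : ∀ u v → E G u v ⇔ F' (to u) (to v)

GridClass : Class
GridClass G = Connected G × Σ GridSubgraph λ H → Iso G (F H)

-- Graphs with a labelled set S = {s_0,…,s_{k-1}} of special vertices:
-- the vertex type is Fin k ⊎ W, the special vertex s_i being inj₁ i.

record LGraph (k : ℕ) : Set₁ where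
  field
    W : Set
    G : GraphOn (Fin k ⊎ W)
open LGraph public

-- g(L,R): identify the special vertex s_i of L with s_i of R.
-- Vertex type: Fin k ⊎ (W_L ⊎ W_R); edges are the union of both edge sets.
module _ {k : ℕ} (L R : LGraph k) where
  private
    EL = E (G L)
    ER = E (G R)

  GlueV : Set
  GlueV = Fin k ⊎ (W L ⊎ W R)

  GlueE : GlueV → GlueV → Set
  GlueE (inj₁ i)        (inj₁ j)        = EL (inj₁ i) (inj₁ j) ⊎ ER (inj₁ i) (inj₁ j)
  GlueE (inj₁ i)        (inj₂ (inj₁ w)) = EL (inj₁ i) (inj₂ w)
  GlueE (inj₁ i)        (inj₂ (inj₂ w)) = ER (inj₁ i) (inj₂ w)
  GlueE (inj₂ (inj₁ w)) (inj₁ j)        = EL (inj₂ w) (inj₁ j)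
  GlueE (inj₂ (inj₁ w)) (inj₂ (inj₁ x)) = EL (inj₂ w) (inj₂ x)
  GlueE (inj₂ (inj₁ w)) (inj₂ (inj₂ x)) = ⊥
  GlueE (inj₂ (inj₂ w)) (inj₁ j)        = ER (inj₂ w) (inj₁ j)
  GlueE (inj₂ (inj₂ w)) (inj₂ (inj₁ x)) = ⊥
  GlueE (inj₂ (inj₂ w)) (inj₂ (inj₂ x)) = ER (inj₂ w) (inj₂ x)

  GlueE-sym : ∀ {u v} → GlueE u v → GlueE v u
  GlueE-sym {inj₁ i}        {inj₁ j}        (inj₁ e) = inj₁ (E-sym (G L) e)
  GlueE-sym {inj₁ i}        {inj₁ j}        (inj₂ e) = inj₂ (E-sym (G R) e)
  GlueE-sym {inj₁ i}        {inj₂ (inj₁ w)} e = E-sym (G L) e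
  GlueE-sym {inj₁ i}        {inj₂ (inj₂ w)} e = E-sym (G R) e
  GlueE-sym {inj₂ (inj₁ w)} {inj₁ j}        e = E-sym (G L) e
  GlueE-sym {inj₂ (inj₁ w)} {inj₂ (inj₁ x)} e = E-sym (G L) e
  GlueE-sym {inj₂ (inj₂ w)} {inj₁ j}        e = E-sym (G R) e
  GlueE-sym {inj₂ (inj₂ w)} {inj₂ (inj₂ x)} e = E-sym (G R) e

  GlueE-irr : ∀ {v} → ¬ GlueE v v
  GlueE-irr {inj₁ i}        (inj₁ e) = E-irr (G L) e
  GlueE-irr {inj₁ i}        (inj₂ e) = E-irr (G R) e
  GlueE-irr {inj₂ (inj₁ w)} e = E-irr (G L) e
  GlueE-irr {inj₂ (inj₂ w)} e = E-irr (G R) e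

  glue : GraphOn GlueV
  glue = record { E = GlueE ; E-sym = λ {u} {v} → GlueE-sym {u} {v} ; E-irr = λ {v} → GlueE-irr {v} }

InNS : {k : ℕ} {X : Set} → GraphOn (Fin k ⊎ X) → Fin k ⊎ X → Set
InNS {k} G v = (Σ (Fin k) λ i → v ≡ inj₁ i) ⊎ (Σ (Fin k) λ i → E G v (inj₁ i))

NSAtMost : ℕ → {k : ℕ} {X : Set} → GraphOn (Fin k ⊎ X) → Set
NSAtMost s {k} {X} G =
  Σ ((v : Fin k ⊎ X) → InNS G v → Fin s) λ f →
    ∀ u v (p : InNS G u) (q : InNS G v) → f u p ≡ f v q → u ≡ v

-- Maps are defined on members of
-- N[S] and required not to depend on the membership proof.
record NSIso {k : ℕ} {X Y : Set} (G₁ : GraphOn (Fin k ⊎ X))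
             (G₂ : GraphOn (Fin k ⊎ Y)) : Set where
  field
    to       : (v : Fin k ⊎ X) → InNS G₁ v → Fin k ⊎ Y
    from     : (w : Fin k ⊎ Y) → InNS G₂ w → Fin k ⊎ X
    to-pi    : ∀ v p p' → to v p ≡ to v p'
    from-pi  : ∀ w q q' → from w q ≡ from w q'
    to-in    : ∀ v p → InNS G₂ (to v p)
    from-in  : ∀ w q → InNS G₁ (from w q)
    from-to  : ∀ v p → from (to v p) (to-in v p) ≡ v
    to-from  : ∀ w q → to (from w q) (from-in w q) ≡ w
    edges    : ∀ u v p q → E G₁ u v ⇔ E G₂ (to u p) (to v q)
    to-S     : ∀ i p → to (inj₁ i) p ≡ inj₁ i

-- Subsets of {1,…,N} are
-- represented as Subset N (subsets of Fin N).  The bound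
-- |V| ≤ α N^{1/κ} is stated as |V|^κ ≤ α^κ N with α a positive natural
-- (equivalent to α a positive real, by rounding α up).

DisjExpr : ℕ → ℕ → Class → Set₁
DisjExpr s κ 𝒞 =
  Σ ℕ λ α → 1 ≤ α ×
  ((N : ℕ) → 1 ≤ N →
    Σ ℕ λ k →
    Σ (Subset N → LGraph k) λ L →
    Σ (Subset N → LGraph k) λ R →
      ((A B : Subset N) →
         Connected (glue (L A) (R B)) ×
         (Σ ℕ λ m → AtMost m (GlueV (L A) (R B)) × m ^ κ ≤ α ^ κ ℕ.* N) ×
         NSAtMost s (glue (L A) (R B)) ×
         (𝒞 (glue (L A) (R B)) ⇔ Empty (A ∩ B)))
      ×
      ((A A' B B' : Subset N) →
         NSIso (glue (L A) (R B)) (glue (L A') (R B'))))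

-- Both gadgets are ladders (two rails of vertices joined by rungs), and a ladder embedded in the
-- grid is forced to be a straight strip of unit squares: once one cell is a square, the next rung
-- cannot turn without colliding with the cell behind it.  L(A) is a C-shaped frame: a vertical
-- 2 × 5 ladder (the bend) leading from the two special vertices to an upper ladder; R(B) continues
-- the special vertices into a lower ladder.  Rigidity makes the two ladders parallel with one free
-- row between them.  For each i both ladders carry a pendant tooth, hanging from the inner rail iff
-- i ∈ A (resp. i ∈ B); there the other three grid neighbours of its attachment point are taken, so
-- it must point into the free row.  If i ∈ A ∩ B both teeth need the same free point; if
-- A ∩ B = ∅ an explicit drawing works.  N[S] consists of the two special vertices and their four
-- frame neighbours.

module Submission where

open import Level using (0ℓ)
open import Algebra.Bundles using (AbelianGroup)
open import Data.Bool using (Bool; true; false)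
open import Data.Empty using (⊥; ⊥-elim)
open import Data.Fin as Fin using (Fin; zero; suc; toℕ; inject₁; _↑ˡ_; _↑ʳ_)
open import Data.Fin.Induction using (<-weakInduction)
open import Data.Fin.Patterns using (0F; 1F; 2F; 3F)
import Data.Fin.Properties as FinP
open import Data.Fin.Subset using (Subset; _∩_; Empty)
open import Data.Fin.Subset.Properties using (x∈p∩q⁺; x∈p∩q⁻)
open import Data.Integer as ℤ using (+_; -[1+_]; _+_; _-_; -_; _*_)
import Data.Integer.Properties as ℤP
open import Data.Integer.Tactic.RingSolver using (solve-∀)
open import Data.Maybe as Maybe using (Maybe; just; nothing)
open import Data.Maybe.Properties using (just-injective)
open import Data.Nat as ℕ using (ℕ; zero; suc; z≤n; s≤s)
import Data.Nat.Properties as ℕP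
import Data.Nat.Tactic.RingSolver as ℕ-Solver
open import Data.Product using (∃; _×_; _,_; proj₁; proj₂)
open import Data.Product.Properties using (≡-dec; ,-injectiveˡ; ,-injectiveʳ)
open import Data.Sum using (_⊎_; inj₁; inj₂)
open import Data.Sum.Function.Propositional using (_⊎-↔_)
open import Data.Vec using (lookup)
open import Data.Vec.Properties using (lookup⇒[]=; []=⇒lookup)
open import Function.Base using (_∘_)
open import Function.Bundles using (_⇔_; mk⇔; _↔_; Inverse; Equivalence)
open import Function.Properties.Inverse using (↔-trans; ↔-refl)
open import Relation.Binary.Core using (Rel)
open import Relation.Binary.Construct.Closure.Symmetric using (SymClosure; fwd; bwd; gfold)
open import Relation.Binary.Construct.Union using (_∪_)
open import Relation.Binary.PropositionalEquality
open import Relation.Nullary using (¬_; contradiction)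
open import Relation.Nullary.Decidable using (from-yes; ¬?; _×-dec_; _⊎-dec_; _→-dec_)
open import Algebra.Properties.Group (AbelianGroup.group ℤP.+-0-abelianGroup) using (∙-cancelˡ)
open import Defs

-- Directions in the grid

-- Fin 4 rather than a data type, so that finite facts about directions are decided by evaluation.
Dir : Set
Dir = Fin 4

pattern east  = 0F
pattern west  = 1F
pattern north = 2F
pattern south = 3F

opposite : Dir → Dir
opposite east  = west
opposite west  = east
opposite north = south
opposite south = north

opposite-involutive : ∀ d → opposite (opposite d) ≡ d
opposite-involutive east  = refl
opposite-involutive west  = refl
opposite-involutive north = refl
opposite-involutive south = refl

opposite-injective : ∀ {a b} → opposite a ≡ opposite b → a ≡ b
opposite-injective {a} {b} eq =
  trans (sym (opposite-involutive a)) (trans (cong opposite eq) (opposite-involutive b))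

unit : Dir → Point
unit east  = + 1 , + 0
unit west  = -[1+ 0 ] , + 0
unit north = + 0 , + 1
unit south = + 0 , -[1+ 0 ]

unit-opposite : ∀ d → unit (opposite d) ≡ (- proj₁ (unit d) , - proj₂ (unit d))
unit-opposite east  = refl
unit-opposite west  = refl
unit-opposite north = refl
unit-opposite south = refl

infixl 6 _+ᵖ_ _⊕_

_+ᵖ_ : Point → Point → Point
(x , y) +ᵖ (x′ , y′) = x + x′ , y + y′

Perpendicular : Dir → Dir → Set
Perpendicular u v = u ≢ v × u ≢ opposite v

-- Both are proved by evaluation; opaque, so that their uses under `with` do not re-run it.
opaque
  unit-sums : ∀ a b c e → unit a +ᵖ unit b ≡ unit c +ᵖ unit e →
              (a ≡ c × b ≡ e) ⊎ (a ≡ e × b ≡ c) ⊎ (b ≡ opposite a × e ≡ opposite c)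
  unit-sums = from-yes
    (FinP.all? λ a → FinP.all? λ b → FinP.all? λ c → FinP.all? λ e →
      ≡-dec ℤ._≟_ ℤ._≟_ (unit a +ᵖ unit b) (unit c +ᵖ unit e) →-dec
      ((a ≟ c ×-dec b ≟ e) ⊎-dec (a ≟ e ×-dec b ≟ c) ⊎-dec
       (b ≟ opposite a ×-dec e ≟ opposite c)))
    where open FinP using (_≟_)

  perpendicular-cover : ∀ {u v} → Perpendicular u v → ∀ w →
                        w ≡ u ⊎ w ≡ opposite u ⊎ w ≡ v ⊎ w ≡ opposite v
  perpendicular-cover {u} {v} = from-yes
    (FinP.all? λ u → FinP.all? λ v → (¬? (u ≟ v) ×-dec ¬? (u ≟ opposite v)) →-dec
      FinP.all? λ w →
      w ≟ u ⊎-dec w ≟ opposite u ⊎-dec w ≟ v ⊎-dec w ≟ opposite v) u v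
    where open FinP using (_≟_)

perpendicular-sym : ∀ {u v} → Perpendicular u v → Perpendicular v u
perpendicular-sym {u} {v} (u≢v , u≢-v) =
  (λ eq → u≢v (sym eq)) ,
  (λ eq → u≢-v (trans (sym (opposite-involutive u)) (cong opposite (sym eq))))

perpendicular-flip : ∀ {u v} → Perpendicular u v → Perpendicular u (opposite v)
perpendicular-flip {u} {v} (u≢v , u≢-v) = u≢-v , λ eq → u≢v (trans eq (opposite-involutive v))

remaining-direction : ∀ {u v} → Perpendicular u v → ∀ {w} →
                      w ≢ u → w ≢ opposite u → w ≢ opposite v → w ≡ v
remaining-direction u⊥v {w} w≢u w≢-u w≢-v with perpendicular-cover u⊥v w
... | inj₁ eq               = contradiction eq w≢u
... | inj₂ (inj₁ eq)        = contradiction eq w≢-u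
... | inj₂ (inj₂ (inj₁ eq)) = eq
... | inj₂ (inj₂ (inj₂ eq)) = contradiction eq w≢-v

-- Opaque, so that unification sees p ⊕ d as rigid in p and d.
opaque
  _⊕_ : Point → Dir → Point
  p ⊕ d = p +ᵖ unit d

  ⊕-comm : ∀ p a b → p ⊕ a ⊕ b ≡ p ⊕ b ⊕ a
  ⊕-comm (x , y) a b = cong₂ _,_ (swap x _ _) (swap y _ _)
    where
    swap : ∀ x i j → x + i + j ≡ x + j + i
    swap = solve-∀

  ⊕-opposite : ∀ p d → p ⊕ d ⊕ opposite d ≡ p
  ⊕-opposite (x , y) d rewrite unit-opposite d = cong₂ _,_ (undo x _) (undo y _)
    where
    undo : ∀ x i → x + i + - i ≡ x
    undo = solve-∀

  two-step-paths : ∀ {p a b c e} → p ⊕ a ⊕ b ≡ p ⊕ c ⊕ e →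
                   (a ≡ c × b ≡ e) ⊎ (a ≡ e × b ≡ c) ⊎ (b ≡ opposite a × e ≡ opposite c)
  two-step-paths {x , y} {a} {b} {c} {e} eq =
    unit-sums a b c e (cong₂ _,_ (cancel x (,-injectiveˡ eq)) (cancel y (,-injectiveʳ eq)))
    where
    cancel : ∀ x {i j k l} → x + i + j ≡ x + k + l → i + j ≡ k + l
    cancel x {i} {j} {k} {l} eq =
      ∙-cancelˡ x _ _ (trans (sym (ℤP.+-assoc x i j)) (trans eq (ℤP.+-assoc x k l)))

step-back : ∀ {p q d} → q ≡ p ⊕ d → p ≡ q ⊕ opposite d
step-back {p} {d = d} refl = sym (⊕-opposite p d)

distinct-neighbours : ∀ {o p q w d} → p ≡ o ⊕ w → q ≡ o ⊕ d → p ≢ q → w ≢ d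
distinct-neighbours p≡o⊕w q≡o⊕d p≢q refl = p≢q (trans p≡o⊕w (sym q≡o⊕d))

-- A record rather than a Σ-type, so that its endpoints can be inferred.
record Adj (p q : Point) : Set where
  constructor _,_
  field
    direction : Dir
    moves     : q ≡ p ⊕ direction

Adj-sym : ∀ {p q} → Adj p q → Adj q p
Adj-sym (d , q≡p⊕d) = opposite d , step-back q≡p⊕d

unit-vector : ∀ a b → a * a + b * b ≡ + 1 → ∃ λ d → (a , b) ≡ unit d
unit-vector (+ 0)           (+ 1)           _  = north , refl
unit-vector (+ 0)           -[1+ 0 ]        _  = south , refl
unit-vector (+ 1)           (+ 0)           _  = east , refl
unit-vector -[1+ 0 ]        (+ 0)           _  = west , refl
unit-vector (+ 0)           (+ 0)           ()
unit-vector (+ 0)           (+ suc (suc _)) ()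
unit-vector (+ 0)           -[1+ suc _ ]    ()
unit-vector (+ 1)           (+ suc _)       ()
unit-vector (+ 1)           -[1+ _ ]        ()
unit-vector (+ suc (suc _)) (+ 0)           ()
unit-vector (+ suc (suc _)) (+ suc _)       ()
unit-vector (+ suc (suc _)) -[1+ _ ]        ()
unit-vector -[1+ 0 ]        (+ suc _)       ()
unit-vector -[1+ 0 ]        -[1+ _ ]        ()
unit-vector -[1+ suc _ ]    (+ 0)           ()
unit-vector -[1+ suc _ ]    (+ suc _)       ()
unit-vector -[1+ suc _ ]    -[1+ _ ]        ()

opaque
  unfolding _⊕_

  GridAdj⇒Adj : ∀ {p q} → GridAdj p q → Adj p q
  GridAdj⇒Adj {x , y} {x′ , y′} g with unit-vector (x - x′) (y - y′) g
  ... | d , eq =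
    Adj-sym (d , cong₂ _,_ (shift x x′ (,-injectiveˡ eq)) (shift y y′ (,-injectiveʳ eq)))
    where
    x≡x′+[x-x′] : ∀ x x′ → x ≡ x′ + (x - x′)
    x≡x′+[x-x′] = solve-∀
    shift : ∀ x x′ {i} → x - x′ ≡ i → x ≡ x′ + i
    shift x x′ refl = x≡x′+[x-x′] x x′

  Adj⇒GridAdj : ∀ {p q} → Adj p q → GridAdj p q
  Adj⇒GridAdj {x , y} (d , refl) =
    subst₂ (λ i j → i * i + j * j ≡ + 1) (sym (x-[x+i] x _)) (sym (x-[x+i] y _)) (unit-norm d)
    where
    x-[x+i] : ∀ x i → x - (x + i) ≡ - i
    x-[x+i] = solve-∀
    unit-norm : ∀ d → let (i , j) = unit d in - i * - i + - j * - j ≡ + 1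
    unit-norm east  = refl
    unit-norm west  = refl
    unit-norm north = refl
    unit-norm south = refl

  Adj-east : ∀ x y → Adj (+ x , + y) (+ suc x , + y)
  Adj-east x y = east , cong₂ _,_ (cong +_ (ℕP.+-comm 1 x)) (cong +_ (sym (ℕP.+-identityʳ y)))

  Adj-north : ∀ x y → Adj (+ x , + y) (+ x , + suc y)
  Adj-north x y = north , cong₂ _,_ (cong +_ (sym (ℕP.+-identityʳ x))) (cong +_ (ℕP.+-comm 1 y))

-- Squares and ladders in the grid

record Square (a b c d : Point) (u v : Dir) : Set where
  field
    perpendicular : Perpendicular u v
    ab : b ≡ a ⊕ u
    bc : c ≡ b ⊕ v
    ad : d ≡ a ⊕ v

  dc : c ≡ d ⊕ u
  dc = begin
    c          ≡⟨ bc ⟩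
    b ⊕ v      ≡⟨ cong (_⊕ v) ab ⟩
    a ⊕ u ⊕ v  ≡⟨ ⊕-comm a u v ⟩
    a ⊕ v ⊕ u  ≡⟨ cong (_⊕ u) ad ⟨
    d ⊕ u      ∎
    where open ≡-Reasoning

rotate : ∀ {a b c d u v} → Square a b c d u v → Square d a b c (opposite v) u
rotate sq = record
  { perpendicular = let u≢v , u≢-v = perpendicular in
                    (λ eq → u≢-v (sym eq)) , (λ eq → u≢v (opposite-injective (sym eq)))
  ; ab = step-back ad
  ; bc = ab
  ; ad = dc
  }
  where open Square sq

-- Among the four directions from b, opposite u leads back to a, v to c, and opposite v would put
-- c′ on b; so the new rung b′c′ continues the square straight on.
square-continue : ∀ {a b c d b′ c′ u v} → Square a b c d u v →
                  Adj b b′ → Adj c c′ → Adj b′ c′ → b′ ≢ a → b′ ≢ c → c′ ≢ b →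
                  Square b b′ c′ c u v
square-continue {b = b} {c} {b′ = b′} {c′} {u} {v} sq
                (w , b′≡b⊕w) (z , c′≡c⊕z) (t , c′≡b′⊕t) b′≢a b′≢c c′≢b
  with two-step-paths (begin
         b ⊕ v ⊕ z  ≡⟨ cong (_⊕ z) bc ⟨
         c ⊕ z      ≡⟨ c′≡c⊕z ⟨
         c′         ≡⟨ c′≡b′⊕t ⟩
         b′ ⊕ t     ≡⟨ cong (_⊕ t) b′≡b⊕w ⟩
         b ⊕ w ⊕ t  ∎)
  where open Square sq; open ≡-Reasoning
... | inj₁ (refl , refl)        = contradiction (trans b′≡b⊕w (sym (Square.bc sq))) b′≢c
... | inj₂ (inj₂ (refl , refl)) = contradiction (trans c′≡c⊕z (sym (step-back (Square.bc sq)))) c′≢b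
... | inj₂ (inj₁ (refl , refl)) = record
  { perpendicular = Square.perpendicular sq
  ; ab = trans b′≡b⊕w (cong (b ⊕_) w≡u)
  ; bc = c′≡b′⊕t
  ; ad = Square.bc sq
  }
  where
  w≡u : w ≡ u
  w≡u = remaining-direction (perpendicular-sym (Square.perpendicular sq))
          (distinct-neighbours b′≡b⊕w (Square.bc sq) b′≢c)
          (distinct-neighbours c′≡c⊕z (step-back (Square.bc sq)) c′≢b)
          (distinct-neighbours b′≡b⊕w (step-back (Square.ab sq)) b′≢a)

four-cycle-square : ∀ {a b c d} → Adj a b → Adj b c → Adj d c → Adj a d → a ≢ c → b ≢ d →
                    ∃ λ u → ∃ λ v → Square a b c d u v
four-cycle-square {a} {b} {c} {d} (u , b≡a⊕u) (x , c≡b⊕x) (y , c≡d⊕y) (v , d≡a⊕v) a≢c b≢d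
  with two-step-paths (begin
         a ⊕ u ⊕ x  ≡⟨ cong (_⊕ x) b≡a⊕u ⟨
         b ⊕ x      ≡⟨ c≡b⊕x ⟨
         c          ≡⟨ c≡d⊕y ⟩
         d ⊕ y      ≡⟨ cong (_⊕ y) d≡a⊕v ⟩
         a ⊕ v ⊕ y  ∎)
  where open ≡-Reasoning
... | inj₁ (refl , refl)        = contradiction (trans b≡a⊕u (sym d≡a⊕v)) b≢d
... | inj₂ (inj₂ (refl , refl)) = contradiction (sym (trans c≡b⊕x (sym (step-back b≡a⊕u)))) a≢c
... | inj₂ (inj₁ (refl , refl)) = u , v , record
  { perpendicular = perpendicular-sym ( distinct-neighbours d≡a⊕v b≡a⊕u (b≢d ∘ sym)
                                      , distinct-neighbours c≡b⊕x (step-back b≡a⊕u) (a≢c ∘ sym))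
  ; ab = b≡a⊕u
  ; bc = c≡b⊕x
  ; ad = d≡a⊕v
  }

suc-suc≢inject₁-inject₁ : ∀ {m} (j : Fin m) → suc (suc j) ≢ inject₁ (inject₁ j)
suc-suc≢inject₁-inject₁ zero    ()
suc-suc≢inject₁-inject₁ (suc j) eq = suc-suc≢inject₁-inject₁ j (FinP.suc-injective eq)

record Ladder {m : ℕ} (a b : Fin (suc m) → Point) : Set where
  field
    rung        : ∀ c → Adj (a c) (b c)
    railᵃ       : ∀ i → Adj (a (inject₁ i)) (a (suc i))
    railᵇ       : ∀ i → Adj (b (inject₁ i)) (b (suc i))
    a-injective : ∀ {c c′} → a c ≡ a c′ → c ≡ c′
    a≢b         : ∀ c c′ → a c ≢ b c′

Cell : ∀ {m} → (Fin (suc m) → Point) → (Fin (suc m) → Point) → Dir → Dir → Fin m → Set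
Cell a b u v i = Square (a (inject₁ i)) (a (suc i)) (b (suc i)) (b (inject₁ i)) u v

ladder-squares : ∀ {m a b u v} → Ladder {suc m} a b → Cell a b u v 0F → ∀ i → Cell a b u v i
ladder-squares {a = a} {b} {u} {v} ladder first = <-weakInduction (Cell a b u v) first next
  where
  open Ladder ladder
  next : ∀ j → Cell a b u v (inject₁ j) → Cell a b u v (suc j)
  next j sq = square-continue sq (railᵃ (suc j)) (railᵇ (suc j)) (rung (suc (suc j)))
    (λ eq → suc-suc≢inject₁-inject₁ j (a-injective eq)) (a≢b _ _) (λ eq → a≢b _ _ (sym eq))

rails-parallel : ∀ {m} {a a′ : Fin (suc m) → Point} {u} e f →
                 (∀ i → a (suc i) ≡ a (inject₁ i) ⊕ u) → (∀ i → a′ (suc i) ≡ a′ (inject₁ i) ⊕ u) →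
                 a 0F ≡ a′ 0F ⊕ e ⊕ f → ∀ c → a c ≡ a′ c ⊕ e ⊕ f
rails-parallel {a = a} {a′} {u} e f railᵃ railᵃ′ first = <-weakInduction Offset first next
  where
  Offset : Fin _ → Set
  Offset c = a c ≡ a′ c ⊕ e ⊕ f
  next : ∀ i → Offset (inject₁ i) → Offset (suc i)
  next i offset = begin
    a (suc i)                   ≡⟨ railᵃ i ⟩
    a (inject₁ i) ⊕ u           ≡⟨ cong (_⊕ u) offset ⟩
    a′ (inject₁ i) ⊕ e ⊕ f ⊕ u  ≡⟨ ⊕-comm (a′ (inject₁ i) ⊕ e) f u ⟩
    a′ (inject₁ i) ⊕ e ⊕ u ⊕ f  ≡⟨ cong (_⊕ f) (⊕-comm (a′ (inject₁ i)) e u) ⟩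
    a′ (inject₁ i) ⊕ u ⊕ e ⊕ f  ≡⟨ cong (λ p → p ⊕ e ⊕ f) (railᵃ′ i) ⟨
    a′ (suc i) ⊕ e ⊕ f          ∎
    where open ≡-Reasoning

module _ {V : Set} {G : GraphOn V} where

  infixr 5 _◅◅_

  _◅◅_ : ∀ {u v w} → Reach G u v → Reach G v w → Reach G u w
  here     ◅◅ q = q
  step e p ◅◅ q = step e (p ◅◅ q)

  edge : ∀ {u v} → E G u v → Reach G u v
  edge e = step e here

  reverse : ∀ {u v} → Reach G u v → Reach G v u
  reverse here       = here
  reverse (step e p) = reverse p ◅◅ edge (E-sym G e)

simpleGraph : {V : Set} (R : Rel V 0ℓ) → (∀ {u v} → R u v → u ≢ v) → GraphOn V
simpleGraph R R⇒≢ = record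
  { E     = SymClosure R
  ; E-sym = λ { (fwd e) → bwd e ; (bwd e) → fwd e }
  ; E-irr = λ { (fwd e) → R⇒≢ e refl ; (bwd e) → R⇒≢ e refl }
  }

module _ {X : Set} {F T T′ : Rel X 0ℓ} (Q : X → Set) (T⇒Q : ∀ {u v} → T u v → Q u) where

  drop-teeth : ∀ {u v} → ¬ Q u → ¬ Q v → SymClosure (F ∪ T) u v → SymClosure (F ∪ T′) u v
  drop-teeth _   _   (fwd (inj₁ e)) = fwd (inj₁ e)
  drop-teeth _   _   (bwd (inj₁ e)) = bwd (inj₁ e)
  drop-teeth ¬Qu _   (fwd (inj₂ e)) = ⊥-elim (¬Qu (T⇒Q e))
  drop-teeth _   ¬Qv (bwd (inj₂ e)) = ⊥-elim (¬Qv (T⇒Q e))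

data LadderEdge : {m : ℕ} → Rel (Fin m × Fin 2) 0ℓ where
  rung : ∀ {m} (j : Fin m) → LadderEdge (j , 0F) (j , 1F)
  rail : ∀ {m} (j : Fin m) r → LadderEdge (inject₁ j , r) (suc j , r)

inject₁≢suc : ∀ {m} (j : Fin m) → inject₁ j ≢ suc j
inject₁≢suc zero    ()
inject₁≢suc (suc j) eq = inject₁≢suc j (FinP.suc-injective eq)

LadderEdge⇒≢ : ∀ {m} {p q : Fin m × Fin 2} → LadderEdge p q → p ≢ q
LadderEdge⇒≢ (rung j)   ()
LadderEdge⇒≢ (rail j r) eq = inject₁≢suc j (cong proj₁ eq)

reach-ladder-origin : ∀ {V : Set} {G : GraphOn V} {m} (f : Fin (suc m) × Fin 2 → V) →
                      (∀ {p q} → LadderEdge p q → E G (f p) (f q)) →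
                      ∀ p → Reach G (f p) (f (0F , 0F))
reach-ladder-origin {G = G} f f-edge (c , r) = to-row₀ r ◅◅ along-rail c
  where
  to-row₀ : ∀ r → Reach G (f (c , r)) (f (c , 0F))
  to-row₀ 0F = here
  to-row₀ 1F = edge (E-sym G (f-edge (rung c)))
  along-rail : ∀ c → Reach G (f (c , 0F)) (f (0F , 0F))
  along-rail = <-weakInduction (λ c → Reach G (f (c , 0F)) (f (0F , 0F))) here
                 (λ i p → edge (E-sym G (f-edge (rail i 0F))) ◅◅ p)

fin? : ∀ {m} → ℕ → Maybe (Fin m)
fin? {zero}  _       = nothing
fin? {suc m} zero    = just zero
fin? {suc m} (suc n) = Maybe.map suc (fin? n)

fin?-toℕ : ∀ {m} (j : Fin m) → fin? (toℕ j) ≡ just j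
fin?-toℕ zero    = refl
fin?-toℕ (suc j) = cong (Maybe.map suc) (fin?-toℕ j)

-- The gadgets

pattern bendᴸ p  = inj₂ (inj₁ p)
pattern upperᴸ p = inj₂ (inj₂ (inj₁ p))
pattern toothᴸ i = inj₂ (inj₂ (inj₂ i))
pattern lowerᴿ p = inj₂ (inj₁ p)
pattern toothᴿ i = inj₂ (inj₂ i)

pattern special r    = inj₁ r
pattern bend p       = inj₂ (inj₁ (inj₁ p))
pattern upper p      = inj₂ (inj₁ (inj₂ (inj₁ p)))
pattern upperTooth i = inj₂ (inj₁ (inj₂ (inj₂ i)))
pattern lower p      = inj₂ (inj₂ (inj₁ p))
pattern lowerTooth i = inj₂ (inj₂ (inj₂ i))

module Construction (N : ℕ) where

  WL WR Vertex : Set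
  WL     = (Fin 5 × Fin 2) ⊎ ((Fin (2 ℕ.+ N) × Fin 2) ⊎ Fin N)
  WR     = (Fin (1 ℕ.+ N) × Fin 2) ⊎ Fin N
  Vertex = Fin 2 ⊎ (WL ⊎ WR)

  order : ℕ
  order = 2 ℕ.+ ((5 ℕ.* 2 ℕ.+ ((2 ℕ.+ N) ℕ.* 2 ℕ.+ N)) ℕ.+ ((1 ℕ.+ N) ℕ.* 2 ℕ.+ N))

  enumerate : Fin order ↔ Vertex
  enumerate = ↔-trans FinP.+↔⊎ (↔-refl ⊎-↔ ↔-trans FinP.+↔⊎ (enumerateᴸ ⊎-↔ enumerateᴿ))
    where
    enumerateᴸ : Fin (5 ℕ.* 2 ℕ.+ ((2 ℕ.+ N) ℕ.* 2 ℕ.+ N)) ↔ WL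
    enumerateᴸ = ↔-trans FinP.+↔⊎ (FinP.*↔× ⊎-↔ ↔-trans FinP.+↔⊎ (FinP.*↔× ⊎-↔ ↔-refl))
    enumerateᴿ : Fin ((1 ℕ.+ N) ℕ.* 2 ℕ.+ N) ↔ WR
    enumerateᴿ = ↔-trans FinP.+↔⊎ (FinP.*↔× ⊎-↔ ↔-refl)

  Vertex-atMost : AtMost order Vertex
  Vertex-atMost =
    from , λ {u} {v} eq → trans (sym (strictlyInverseˡ u)) (trans (cong to eq) (strictlyInverseˡ v))
    where open Inverse enumerate

  -- A tooth sits on the inner row of its ladder, pointing into the gap, exactly when i is in the set.
  upper-row lower-row : Bool → Fin 2
  upper-row true  = 0F
  upper-row false = 1F
  lower-row true  = 1F
  lower-row false = 0F

  data LeftFrame : Rel (Fin 2 ⊎ WL) 0ℓ where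
    along-bend   : ∀ {p q} → LadderEdge p q → LeftFrame (bendᴸ p) (bendᴸ q)
    along-upper  : ∀ {p q} → LadderEdge p q → LeftFrame (upperᴸ p) (upperᴸ q)
    specials     : LeftFrame (inj₁ 0F) (inj₁ 1F)
    bend-special : ∀ r → LeftFrame (bendᴸ (r ↑ˡ 3 , 0F)) (inj₁ r)
    bend-upper   : ∀ r → LeftFrame (bendᴸ (3 ↑ʳ r , 0F)) (upperᴸ (0F , r))

  data LeftTooth (A : Subset N) : Rel (Fin 2 ⊎ WL) 0ℓ where
    tooth : ∀ i → LeftTooth A (toothᴸ i) (upperᴸ (suc (inject₁ i) , upper-row (lookup A i)))

  data RightFrame : Rel (Fin 2 ⊎ WR) 0ℓ where
    along-lower   : ∀ {p q} → LadderEdge p q → RightFrame (lowerᴿ p) (lowerᴿ q)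
    special-lower : ∀ r → RightFrame (inj₁ r) (lowerᴿ (0F , r))

  data RightTooth (B : Subset N) : Rel (Fin 2 ⊎ WR) 0ℓ where
    tooth : ∀ i → RightTooth B (toothᴿ i) (lowerᴿ (inject₁ i , lower-row (lookup B i)))

  LeftEdge : Subset N → Rel (Fin 2 ⊎ WL) 0ℓ
  LeftEdge A = LeftFrame ∪ LeftTooth A

  RightEdge : Subset N → Rel (Fin 2 ⊎ WR) 0ℓ
  RightEdge B = RightFrame ∪ RightTooth B

  LeftEdge⇒≢ : ∀ {A u v} → LeftEdge A u v → u ≢ v
  LeftEdge⇒≢ (inj₁ (along-bend e))  refl = LadderEdge⇒≢ e refl
  LeftEdge⇒≢ (inj₁ (along-upper e)) refl = LadderEdge⇒≢ e refl

  RightEdge⇒≢ : ∀ {B u v} → RightEdge B u v → u ≢ v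
  RightEdge⇒≢ (inj₁ (along-lower e)) refl = LadderEdge⇒≢ e refl

  L : Subset N → LGraph 2
  L A = record { W = WL ; G = simpleGraph (LeftEdge A) LeftEdge⇒≢ }

  R : Subset N → LGraph 2
  R B = record { W = WR ; G = simpleGraph (RightEdge B) RightEdge⇒≢ }

  Γ : Subset N → Subset N → GraphOn Vertex
  Γ A B = glue (L A) (R B)

  ιᴸ : Fin 2 ⊎ WL → Vertex
  ιᴸ (inj₁ r) = inj₁ r
  ιᴸ (inj₂ w) = inj₂ (inj₁ w)

  ιᴿ : Fin 2 ⊎ WR → Vertex
  ιᴿ (inj₁ r) = inj₁ r
  ιᴿ (inj₂ w) = inj₂ (inj₂ w)

  -- The three ladders of the rigidity argument, as maps column ↦ row ↦ vertex.
  bottom : Fin (3 ℕ.+ N) → Fin 2 → Vertex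
  bottom 0F            r = bend (r ↑ˡ 3 , 0F)
  bottom 1F            r = special r
  bottom (suc (suc j)) r = lower (j , r)

  vertical : Fin 5 → Fin 2 → Vertex
  vertical y r = bend (y , r)

  top : Fin (4 ℕ.+ N) → Fin 2 → Vertex
  top 0F            r = bend (3 ↑ʳ r , 1F)
  top 1F            r = bend (3 ↑ʳ r , 0F)
  top (suc (suc j)) r = upper (j , r)

  bottom-injective : ∀ {c r c′ r′} → bottom c r ≡ bottom c′ r′ → c ≡ c′ × r ≡ r′
  bottom-injective {0F}          {0F} {0F}          {0F} refl = refl , refl
  bottom-injective {0F}          {1F} {0F}          {1F} refl = refl , refl
  bottom-injective {0F}          {0F} {0F}          {1F} ()
  bottom-injective {0F}          {1F} {0F}          {0F} ()
  bottom-injective {0F}          {_}  {1F}          {_}  ()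
  bottom-injective {0F}          {_}  {suc (suc _)} {_}  ()
  bottom-injective {1F}          {_}  {1F}          {_}  refl = refl , refl
  bottom-injective {suc (suc _)} {_}  {suc (suc _)} {_}  refl = refl , refl

  top-injective : ∀ {c r c′ r′} → top c r ≡ top c′ r′ → c ≡ c′ × r ≡ r′
  top-injective {0F}          {0F} {0F}          {0F} refl = refl , refl
  top-injective {0F}          {1F} {0F}          {1F} refl = refl , refl
  top-injective {0F}          {0F} {0F}          {1F} ()
  top-injective {0F}          {1F} {0F}          {0F} ()
  top-injective {0F}          {_}  {1F}          {_}  ()
  top-injective {0F}          {_}  {suc (suc _)} {_}  ()
  top-injective {1F}          {0F} {1F}          {0F} refl = refl , refl
  top-injective {1F}          {1F} {1F}          {1F} refl = refl , refl
  top-injective {1F}          {0F} {1F}          {1F} ()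
  top-injective {1F}          {1F} {1F}          {0F} ()
  top-injective {1F}          {_}  {0F}          {_}  ()
  top-injective {1F}          {_}  {suc (suc _)} {_}  ()
  top-injective {suc (suc _)} {_}  {suc (suc _)} {_}  refl = refl , refl

  lowerTooth≢bottom : ∀ {i} c r → lowerTooth i ≢ bottom c r
  lowerTooth≢bottom 0F            _ ()
  lowerTooth≢bottom 1F            _ ()
  lowerTooth≢bottom (suc (suc _)) _ ()

  module Edges (A B : Subset N) where

    glueᴸ : ∀ {u v} → SymClosure (LeftEdge A) u v → E (Γ A B) (ιᴸ u) (ιᴸ v)
    glueᴸ {inj₁ _} {inj₁ _} e = inj₁ e
    glueᴸ {inj₁ _} {inj₂ _} e = e
    glueᴸ {inj₂ _} {inj₁ _} e = e
    glueᴸ {inj₂ _} {inj₂ _} e = e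

    glueᴿ : ∀ {u v} → SymClosure (RightEdge B) u v → E (Γ A B) (ιᴿ u) (ιᴿ v)
    glueᴿ {inj₁ _} {inj₁ _} e = inj₂ e
    glueᴿ {inj₁ _} {inj₂ _} e = e
    glueᴿ {inj₂ _} {inj₁ _} e = e
    glueᴿ {inj₂ _} {inj₂ _} e = e

    glue-elim : (P : Vertex → Vertex → Set) →
                (∀ {u v} → SymClosure (LeftEdge A) u v → P (ιᴸ u) (ιᴸ v)) →
                (∀ {u v} → SymClosure (RightEdge B) u v → P (ιᴿ u) (ιᴿ v)) →
                ∀ {u v} → E (Γ A B) u v → P u v
    glue-elim P left right {inj₁ _}        {inj₁ _}        (inj₁ e) = left e
    glue-elim P left right {inj₁ _}        {inj₁ _}        (inj₂ e) = right e
    glue-elim P left right {inj₁ _}        {inj₂ (inj₁ _)} e        = left e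
    glue-elim P left right {inj₁ _}        {inj₂ (inj₂ _)} e        = right e
    glue-elim P left right {inj₂ (inj₁ _)} {inj₁ _}        e        = left e
    glue-elim P left right {inj₂ (inj₁ _)} {inj₂ (inj₁ _)} e        = left e
    glue-elim P left right {inj₂ (inj₂ _)} {inj₁ _}        e        = right e
    glue-elim P left right {inj₂ (inj₂ _)} {inj₂ (inj₂ _)} e        = right e

    frameᴸ : ∀ {u v} → LeftFrame u v → E (Γ A B) (ιᴸ u) (ιᴸ v)
    frameᴸ e = glueᴸ (fwd (inj₁ e))

    frameᴸ˘ : ∀ {u v} → LeftFrame u v → E (Γ A B) (ιᴸ v) (ιᴸ u)
    frameᴸ˘ e = glueᴸ (bwd (inj₁ e))

    frameᴿ : ∀ {u v} → RightFrame u v → E (Γ A B) (ιᴿ u) (ιᴿ v)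
    frameᴿ e = glueᴿ (fwd (inj₁ e))

    frameᴿ˘ : ∀ {u v} → RightFrame u v → E (Γ A B) (ιᴿ v) (ιᴿ u)
    frameᴿ˘ e = glueᴿ (bwd (inj₁ e))

    bottom-rung : ∀ c → E (Γ A B) (bottom c 0F) (bottom c 1F)
    bottom-rung 0F            = frameᴸ (along-bend (rail 0F 0F))
    bottom-rung 1F            = frameᴸ specials
    bottom-rung (suc (suc j)) = frameᴿ (along-lower (rung j))

    bottom-rail : ∀ i r → E (Γ A B) (bottom (inject₁ i) r) (bottom (suc i) r)
    bottom-rail 0F            r = frameᴸ (bend-special r)
    bottom-rail 1F            r = frameᴿ (special-lower r)
    bottom-rail (suc (suc j)) r = frameᴿ (along-lower (rail j r))

    vertical-rung : ∀ c → E (Γ A B) (vertical c 0F) (vertical c 1F)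
    vertical-rung y = frameᴸ (along-bend (rung y))

    vertical-rail : ∀ i r → E (Γ A B) (vertical (inject₁ i) r) (vertical (suc i) r)
    vertical-rail y r = frameᴸ (along-bend (rail y r))

    top-rung : ∀ c → E (Γ A B) (top c 0F) (top c 1F)
    top-rung 0F            = frameᴸ (along-bend (rail 3F 1F))
    top-rung 1F            = frameᴸ (along-bend (rail 3F 0F))
    top-rung (suc (suc j)) = frameᴸ (along-upper (rung j))

    top-rail : ∀ i r → E (Γ A B) (top (inject₁ i) r) (top (suc i) r)
    top-rail 0F            r = frameᴸ˘ (along-bend (rung (3 ↑ʳ r)))
    top-rail 1F            r = frameᴸ (bend-upper r)
    top-rail (suc (suc j)) r = frameᴸ (along-upper (rail j r))

    reach-bend : ∀ p → Reach (Γ A B) (bend p) (special 0F)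
    reach-bend p = reach-ladder-origin bend (frameᴸ ∘ along-bend) p ◅◅ edge (frameᴸ (bend-special 0F))

    reach-upper : ∀ p → Reach (Γ A B) (upper p) (special 0F)
    reach-upper p = reach-ladder-origin upper (frameᴸ ∘ along-upper) p
                 ◅◅ edge (frameᴸ˘ (bend-upper 0F)) ◅◅ reach-bend _

    reach-lower : ∀ p → Reach (Γ A B) (lower p) (special 0F)
    reach-lower p = reach-ladder-origin lower (frameᴿ ∘ along-lower) p
                 ◅◅ edge (frameᴿ˘ (special-lower 0F))

    reach-special₀ : ∀ v → Reach (Γ A B) v (special 0F)
    reach-special₀ (special 0F)   = here
    reach-special₀ (special 1F)   = edge (frameᴸ˘ specials)
    reach-special₀ (bend p)       = reach-bend p
    reach-special₀ (upper p)      = reach-upper p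
    reach-special₀ (upperTooth i) = edge (glueᴸ (fwd (inj₂ (tooth i)))) ◅◅ reach-upper _
    reach-special₀ (lower p)      = reach-lower p
    reach-special₀ (lowerTooth i) = edge (glueᴿ (fwd (inj₂ (tooth i)))) ◅◅ reach-lower _

    Γ-connected : Connected (Γ A B)
    Γ-connected u v = reach-special₀ u ◅◅ reverse (reach-special₀ v)

  -- The closed neighbourhood of the special vertices

  special-neighbourᴸ : ∀ {A w i} → SymClosure (LeftEdge A) (inj₂ w) (inj₁ i) → w ≡ inj₁ (i ↑ˡ 3 , 0F)
  special-neighbourᴸ (fwd (inj₁ (bend-special r))) = refl
  special-neighbourᴸ (fwd (inj₂ ()))
  special-neighbourᴸ (bwd (inj₁ ()))
  special-neighbourᴸ (bwd (inj₂ ()))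

  special-neighbourᴿ : ∀ {B w i} → SymClosure (RightEdge B) (inj₂ w) (inj₁ i) → w ≡ inj₁ (0F , i)
  special-neighbourᴿ (bwd (inj₁ (special-lower r))) = refl
  special-neighbourᴿ (fwd (inj₁ ()))
  special-neighbourᴿ (fwd (inj₂ ()))
  special-neighbourᴿ (bwd (inj₂ ()))

  NS-vertex : Fin 3 × Fin 2 → Vertex
  NS-vertex (0F , r) = special r
  NS-vertex (1F , r) = bend (r ↑ˡ 3 , 0F)
  NS-vertex (2F , r) = lower (0F , r)

  InNS⇒NS-vertex : ∀ {A B v} → InNS (Γ A B) v → ∃ λ k → NS-vertex k ≡ v
  InNS⇒NS-vertex (inj₁ (r , refl))                 = (0F , r) , refl
  InNS⇒NS-vertex {v = inj₁ r}        (inj₂ _)       = (0F , r) , refl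
  InNS⇒NS-vertex {v = inj₂ (inj₁ _)} (inj₂ (i , e)) =
    (1F , i) , cong (inj₂ ∘ inj₁) (sym (special-neighbourᴸ e))
  InNS⇒NS-vertex {v = inj₂ (inj₂ _)} (inj₂ (i , e)) =
    (2F , i) , cong (inj₂ ∘ inj₂) (sym (special-neighbourᴿ e))

  NS-atMost : ∀ {A B} → NSAtMost 6 (Γ A B)
  NS-atMost = (λ _ p → code (InNS⇒NS-vertex p)) ,
              λ u v p q eq → trans (sym (decode-code (InNS⇒NS-vertex p)))
                                   (trans (cong decode eq) (decode-code (InNS⇒NS-vertex q)))
    where
    code : ∀ {v} → (∃ λ k → NS-vertex k ≡ v) → Fin 6
    code ((k , r) , _) = Fin.combine k r
    decode : Fin 6 → Vertex
    decode c = NS-vertex (Fin.remQuot 2 c)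
    decode-code : ∀ {v} (x : ∃ λ k → NS-vertex k ≡ v) → decode (code x) ≡ v
    decode-code ((k , r) , refl) = cong NS-vertex (FinP.remQuot-combine k r)

  data IsToothᴸ : Fin 2 ⊎ WL → Set where
    tooth : ∀ i → IsToothᴸ (toothᴸ i)

  data IsToothᴿ : Fin 2 ⊎ WR → Set where
    tooth : ∀ i → IsToothᴿ (toothᴿ i)

  module _ {A B A′ B′ : Subset N} where

    private
      dropᴸ : ∀ {u v} → ¬ IsToothᴸ u → ¬ IsToothᴸ v →
              SymClosure (LeftEdge A) u v → SymClosure (LeftEdge A′) u v
      dropᴸ = drop-teeth IsToothᴸ λ { (tooth i) → tooth i }

      dropᴿ : ∀ {u v} → ¬ IsToothᴿ u → ¬ IsToothᴿ v →
              SymClosure (RightEdge B) u v → SymClosure (RightEdge B′) u v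
      dropᴿ = drop-teeth IsToothᴿ λ { (tooth i) → tooth i }

    NS-edge : ∀ k k′ → E (Γ A B) (NS-vertex k) (NS-vertex k′) →
                       E (Γ A′ B′) (NS-vertex k) (NS-vertex k′)
    NS-edge (0F , _) (0F , _) (inj₁ e) = inj₁ (dropᴸ (λ ()) (λ ()) e)
    NS-edge (0F , _) (0F , _) (inj₂ e) = inj₂ (dropᴿ (λ ()) (λ ()) e)
    NS-edge (0F , _) (1F , _) e        = dropᴸ (λ ()) (λ ()) e
    NS-edge (0F , _) (2F , _) e        = dropᴿ (λ ()) (λ ()) e
    NS-edge (1F , _) (0F , _) e        = dropᴸ (λ ()) (λ ()) e
    NS-edge (1F , _) (1F , _) e        = dropᴸ (λ ()) (λ ()) e
    NS-edge (1F , _) (2F , _) ()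
    NS-edge (2F , _) (0F , _) e        = dropᴿ (λ ()) (λ ()) e
    NS-edge (2F , _) (2F , _) e        = dropᴿ (λ ()) (λ ()) e

    InNS-transfer : ∀ {v} → InNS (Γ A B) v → InNS (Γ A′ B′) v
    InNS-transfer (inj₁ s) = inj₁ s
    InNS-transfer p@(inj₂ (i , e)) with InNS⇒NS-vertex p
    ... | k , refl = inj₂ (i , NS-edge k (0F , i) e)

  NS-iso : ∀ A A′ B B′ → NSIso (Γ A B) (Γ A′ B′)
  NS-iso A A′ B B′ = record
    { to      = λ v _ → v
    ; from    = λ v _ → v
    ; to-pi   = λ _ _ _ → refl
    ; from-pi = λ _ _ _ → refl
    ; to-in   = λ _ → InNS-transfer
    ; from-in = λ _ → InNS-transfer
    ; from-to = λ _ _ → refl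
    ; to-from = λ _ _ → refl
    ; edges   = edges
    ; to-S    = λ _ _ → refl
    }
    where
    edges : ∀ u v → InNS (Γ A B) u → InNS (Γ A B) v → E (Γ A B) u v ⇔ E (Γ A′ B′) u v
    edges u v p q with InNS⇒NS-vertex p | InNS⇒NS-vertex q
    ... | k , refl | k′ , refl = mk⇔ (NS-edge k k′) (NS-edge k k′)

  -- Drawing the glued graph when A ∩ B = ∅

  module Drawing (A B : Subset N) where
    open Edges A B

    upper-tooth-y lower-tooth-y : Bool → ℕ
    upper-tooth-y true  = 3
    upper-tooth-y false = 6
    lower-tooth-y true  = 3
    lower-tooth-y false = 0

    bend-x : Fin 2 → ℕ
    bend-x 0F = 1
    bend-x 1F = 0

    coords : Vertex → ℕ × ℕ
    coords (special r)     = 2 , 1 ℕ.+ toℕ r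
    coords (bend (y , r))  = bend-x r , 1 ℕ.+ toℕ y
    coords (upper (j , r)) = 2 ℕ.+ toℕ j , 4 ℕ.+ toℕ r
    coords (upperTooth i)  = 3 ℕ.+ toℕ i , upper-tooth-y (lookup A i)
    coords (lower (j , r)) = 3 ℕ.+ toℕ j , 1 ℕ.+ toℕ r
    coords (lowerTooth i)  = 3 ℕ.+ toℕ i , lower-tooth-y (lookup B i)

    position : Vertex → Point
    position v = + proj₁ (coords v) , + proj₂ (coords v)

    private
      Adj-west : ∀ x y → Adj (+ suc x , + y) (+ x , + y)
      Adj-west x y = Adj-sym (Adj-east x y)

      Adj-south : ∀ x y → Adj (+ x , + suc y) (+ x , + y)
      Adj-south x y = Adj-sym (Adj-north x y)

    ladder-step : ∀ {m} x₀ y₀ {p q : Fin m × Fin 2} → LadderEdge p q →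
                  Adj (+ (x₀ ℕ.+ toℕ (proj₁ p)) , + (y₀ ℕ.+ toℕ (proj₂ p)))
                      (+ (x₀ ℕ.+ toℕ (proj₁ q)) , + (y₀ ℕ.+ toℕ (proj₂ q)))
    ladder-step x₀ y₀ (rung j)   rewrite ℕP.+-suc y₀ 0 = Adj-north _ _
    ladder-step x₀ y₀ (rail j r) rewrite FinP.toℕ-inject₁ j | ℕP.+-suc x₀ (toℕ j) = Adj-east _ _

    bend-step : ∀ {p q : Fin 5 × Fin 2} → LadderEdge p q → Adj (position (bend p)) (position (bend q))
    bend-step (rung y)   = Adj-west _ _
    bend-step (rail y r) rewrite FinP.toℕ-inject₁ y = Adj-north _ _

    left-step : ∀ {u v} → LeftEdge A u v → Adj (position (ιᴸ u)) (position (ιᴸ v))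
    left-step (inj₁ (along-bend e))    = bend-step e
    left-step (inj₁ (along-upper e))   = ladder-step 2 4 e
    left-step (inj₁ specials)          = Adj-north _ _
    left-step (inj₁ (bend-special 0F)) = Adj-east _ _
    left-step (inj₁ (bend-special 1F)) = Adj-east _ _
    left-step (inj₁ (bend-upper 0F))   = Adj-east _ _
    left-step (inj₁ (bend-upper 1F))   = Adj-east _ _
    left-step (inj₂ (tooth i)) rewrite FinP.toℕ-inject₁ i with lookup A i
    ... | true  = Adj-north _ _
    ... | false = Adj-south _ _

    right-step : ∀ {u v} → RightEdge B u v → Adj (position (ιᴿ u)) (position (ιᴿ v))
    right-step (inj₁ (along-lower e))   = ladder-step 3 1 e
    right-step (inj₁ (special-lower r)) = Adj-east _ _
    right-step (inj₂ (tooth i)) rewrite FinP.toℕ-inject₁ i with lookup B i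
    ... | true  = Adj-south _ _
    ... | false = Adj-north _ _

    Γ-step : ∀ {u v} → E (Γ A B) u v → Adj (position u) (position v)
    Γ-step {u} {v} = glue-elim (λ u v → Adj (position u) (position v))
                       (gfold (λ {p q} → Adj-sym {p} {q}) (position ∘ ιᴸ) left-step)
                       (gfold (λ {p q} → Adj-sym {p} {q}) (position ∘ ιᴿ) right-step) {u} {v}

    middle-tooth : Fin N → Vertex
    middle-tooth i with lookup A i
    ... | true  = upperTooth i
    ... | false = lowerTooth i

    locate : ℕ → ℕ → Maybe Vertex
    locate 0 (suc y)             = Maybe.map (λ y → bend (y , 1F)) (fin? y)
    locate 1 (suc y)             = Maybe.map (λ y → bend (y , 0F)) (fin? y)
    locate 2 1                   = just (special 0F)
    locate 2 2                   = just (special 1F)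
    locate 2 4                   = just (upper (0F , 0F))
    locate 2 5                   = just (upper (0F , 1F))
    locate (suc (suc (suc i))) 0 = Maybe.map lowerTooth (fin? i)
    locate (suc (suc (suc i))) 1 = Maybe.map (λ j → lower (j , 0F)) (fin? i)
    locate (suc (suc (suc i))) 2 = Maybe.map (λ j → lower (j , 1F)) (fin? i)
    locate (suc (suc (suc i))) 3 = Maybe.map middle-tooth (fin? i)
    locate (suc (suc (suc i))) 4 = Maybe.map (λ j → upper (suc j , 0F)) (fin? i)
    locate (suc (suc (suc i))) 5 = Maybe.map (λ j → upper (suc j , 1F)) (fin? i)
    locate (suc (suc (suc i))) 6 = Maybe.map upperTooth (fin? i)
    locate _ _                   = nothing

    module _ (disjoint : Empty (A ∩ B)) where

      locate-coords : ∀ v → locate (proj₁ (coords v)) (proj₂ (coords v)) ≡ just v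
      locate-coords (special 0F)         = refl
      locate-coords (special 1F)         = refl
      locate-coords (bend (y , 0F))      rewrite fin?-toℕ y = refl
      locate-coords (bend (y , 1F))      rewrite fin?-toℕ y = refl
      locate-coords (upper (0F , 0F))    = refl
      locate-coords (upper (0F , 1F))    = refl
      locate-coords (upper (suc j , 0F)) rewrite fin?-toℕ j = refl
      locate-coords (upper (suc j , 1F)) rewrite fin?-toℕ j = refl
      locate-coords (lower (j , 0F))     rewrite fin?-toℕ j = refl
      locate-coords (lower (j , 1F))     rewrite fin?-toℕ j = refl
      locate-coords (upperTooth i) with lookup A i in i∈A
      ... | true  rewrite fin?-toℕ i | i∈A = refl
      ... | false rewrite fin?-toℕ i = refl
      locate-coords (lowerTooth i) with lookup B i in i∈B
      ... | false rewrite fin?-toℕ i = refl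
      ... | true with lookup A i in i∈A
      ...   | true  = ⊥-elim (disjoint (i , x∈p∩q⁺ (lookup⇒[]= i A i∈A , lookup⇒[]= i B i∈B)))
      ...   | false rewrite fin?-toℕ i | i∈A = refl

      position-injective : ∀ {u v} → position u ≡ position v → u ≡ v
      position-injective {u} {v} eq = just-injective (begin
        just u                                        ≡⟨ locate-coords u ⟨
        locate (proj₁ (coords u)) (proj₂ (coords u))  ≡⟨ cong₂ locate (ℤP.+-injective (,-injectiveˡ eq))
                                                                       (ℤP.+-injective (,-injectiveʳ eq)) ⟩
        locate (proj₁ (coords v)) (proj₂ (coords v))  ≡⟨ locate-coords v ⟩
        just v                                        ∎)
        where open ≡-Reasoning

  grid-drawing : ∀ {A B} → Empty (A ∩ B) → GridClass (Γ A B)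
  grid-drawing {A} {B} disjoint = Γ-connected , H , iso
    where
    open Edges A B
    open Drawing A B
    open Inverse enumerate
    to-injective : ∀ {i j} → to i ≡ to j → i ≡ j
    to-injective {i} {j} eq =
      trans (sym (strictlyInverseʳ i)) (trans (cong from eq) (strictlyInverseʳ j))
    H : GridSubgraph
    H = record
      { n       = order
      ; pos     = position ∘ to
      ; pos-inj = λ {i} {j} eq → to-injective (position-injective disjoint {to i} {to j} eq)
      ; F       = λ i j → E (Γ A B) (to i) (to j)
      ; F-sym   = λ {i} {j} → E-sym (Γ A B) {to i} {to j}
      ; F-grid  = λ {i} {j} e → Adj⇒GridAdj (Γ-step {to i} {to j} e)
      }
    iso : Iso (Γ A B) (F H)
    iso = record
      { to      = from
      ; from    = to
      ; from-to = strictlyInverseˡ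
      ; to-from = strictlyInverseʳ
      ; edges   = λ u v → mk⇔ (subst₂ (E (Γ A B)) (sym (strictlyInverseˡ u)) (sym (strictlyInverseˡ v)))
                               (subst₂ (E (Γ A B)) (strictlyInverseˡ u) (strictlyInverseˡ v))
      }

  -- Rigidity of every grid drawing

  module Rigidity {A B : Subset N} (grid : GridClass (Γ A B)) where
    open Edges A B
    private
      H : GridSubgraph
      H = proj₁ (proj₂ grid)
      I : Iso (Γ A B) (F H)
      I = proj₂ (proj₂ grid)

    P : Vertex → Point
    P v = pos H (Iso.to I v)

    P-injective : ∀ {u v} → P u ≡ P v → u ≡ v
    P-injective {u} {v} eq =
      trans (sym (Iso.from-to I u)) (trans (cong (Iso.from I) (pos-inj H eq)) (Iso.from-to I v))

    P-distinct : ∀ {x y} → x ≢ y → P x ≢ P y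
    P-distinct x≢y eq = x≢y (P-injective eq)

    adj : ∀ {u v} → E (Γ A B) u v → Adj (P u) (P v)
    adj {u} {v} e = GridAdj⇒Adj (F-grid H (Equivalence.to (Iso.edges I u v) e))

    row : ∀ {m} → (Fin m → Fin 2 → Vertex) → Fin 2 → Fin m → Point
    row col r c = P (col c r)

    ladder : ∀ {m} (col : Fin (suc m) → Fin 2 → Vertex) →
             (∀ {c r c′ r′} → col c r ≡ col c′ r′ → c ≡ c′ × r ≡ r′) →
             (∀ c → E (Γ A B) (col c 0F) (col c 1F)) →
             (∀ i r → E (Γ A B) (col (inject₁ i) r) (col (suc i) r)) →
             Ladder (row col 0F) (row col 1F)
    ladder col col-injective col-rung col-rail = record
      { rung        = λ c → adj (col-rung c)
      ; railᵃ       = λ i → adj (col-rail i 0F)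
      ; railᵇ       = λ i → adj (col-rail i 1F)
      ; a-injective = λ eq → proj₁ (col-injective (P-injective eq))
      ; a≢b         = λ c c′ eq → 0F≢1F (proj₂ (col-injective (P-injective eq)))
      }
      where
      0F≢1F : 0F ≢ 1F
      0F≢1F ()

    -- Opaque, so that u and v stay neutral instead of unfolding into the proof of four-cycle-square.
    opaque
      first-square : ∃ λ u → ∃ λ v → Cell (row bottom 0F) (row bottom 1F) u v 0F
      first-square = four-cycle-square (adj (bottom-rail 0F 0F)) (adj (bottom-rung 1F))
                       (adj (bottom-rail 0F 1F)) (adj (bottom-rung 0F)) (P-distinct λ ()) (P-distinct λ ())

    u v : Dir
    u = proj₁ first-square
    v = proj₁ (proj₂ first-square)

    bottom-squares : ∀ i → Cell (row bottom 0F) (row bottom 1F) u v i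
    bottom-squares = ladder-squares (ladder bottom bottom-injective bottom-rung bottom-rail)
                                    (proj₂ (proj₂ first-square))

    -- The bend continues the first bottom cell backwards and then turns it by a right angle.
    vertical-squares : ∀ i → Cell (row vertical 0F) (row vertical 1F) v (opposite u) i
    vertical-squares =
      ladder-squares (ladder vertical (λ { refl → refl , refl }) vertical-rung vertical-rail)
                     (subst (λ d → Cell (row vertical 0F) (row vertical 1F) d (opposite u) 0F)
                            (opposite-involutive v) (rotate behind))
      where
      behind : Square (P (vertical 1F 0F)) (P (vertical 1F 1F)) (P (vertical 0F 1F)) (P (vertical 0F 0F))
                      (opposite u) (opposite v)
      behind = square-continue (rotate (rotate (bottom-squares 0F)))
                 (adj (vertical-rung 1F)) (adj (vertical-rung 0F))
                 (adj (frameᴸ˘ (along-bend (rail 0F 1F))))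
                 (P-distinct λ ()) (P-distinct λ ()) (P-distinct λ ())

    top-squares : ∀ i → Cell (row top 0F) (row top 1F) u v i
    top-squares = ladder-squares (ladder top top-injective top-rung top-rail)
                                 (subst (λ d → Cell (row top 0F) (row top 1F) d v 0F)
                                        (opposite-involutive u) (rotate (vertical-squares 3F)))

    upper-above-lower : ∀ c → P (top (suc c) 0F) ≡ P (bottom c 1F) ⊕ v ⊕ v
    upper-above-lower = rails-parallel v v
      (λ i → Square.ab (top-squares (suc i))) (λ i → Square.dc (bottom-squares i))
      (trans (Square.ab (vertical-squares 2F)) (cong (_⊕ v) (Square.ab (vertical-squares 1F))))

    upper-tooth : ∀ i → lookup A i ≡ true →
                  P (upperTooth i) ≡ P (top (suc (suc (suc (inject₁ i)))) 0F) ⊕ opposite v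
    upper-tooth i i∈A = trans moves (cong (P h ⊕_) direction≡-v)
      where
      h : Vertex
      h = top (suc (suc (suc (inject₁ i)))) 0F
      attach : Adj (P h) (P (upperTooth i))
      attach = adj (subst (λ b → E (Γ A B) (upper (suc (inject₁ i) , upper-row b)) (upperTooth i))
                          i∈A (glueᴸ (bwd (inj₂ (tooth i)))))
      open Adj attach
      before : Cell (row top 0F) (row top 1F) u v (suc (suc (inject₁ i)))
      before = top-squares (suc (suc (inject₁ i)))
      after : Cell (row top 0F) (row top 1F) u v (suc (suc (suc i)))
      after = top-squares (suc (suc (suc i)))
      direction≢v : direction ≢ v
      direction≢v = distinct-neighbours moves (Square.bc before) (P-distinct λ ())
      direction≡-v : direction ≡ opposite v
      direction≡-v = remaining-direction (perpendicular-flip (Square.perpendicular before))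
        (distinct-neighbours moves (Square.ab after) (P-distinct λ ()))
        (distinct-neighbours moves (step-back (Square.ab before)) (P-distinct λ ()))
        (λ eq → direction≢v (trans eq (opposite-involutive v)))

    lower-tooth : ∀ i → lookup B i ≡ true →
                  P (lowerTooth i) ≡ P (bottom (suc (suc (inject₁ i))) 1F) ⊕ v
    lower-tooth i i∈B = trans moves (cong (P g ⊕_) direction≡v)
      where
      g : Vertex
      g = bottom (suc (suc (inject₁ i))) 1F
      attach : Adj (P g) (P (lowerTooth i))
      attach = adj (subst (λ b → E (Γ A B) (lower (inject₁ i , lower-row b)) (lowerTooth i))
                          i∈B (glueᴿ (bwd (inj₂ (tooth i)))))
      open Adj attach
      before : Cell (row bottom 0F) (row bottom 1F) u v (suc (inject₁ i))
      before = bottom-squares (suc (inject₁ i))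
      after : Cell (row bottom 0F) (row bottom 1F) u v (suc (suc i))
      after = bottom-squares (suc (suc i))
      direction≡v : direction ≡ v
      direction≡v = remaining-direction (Square.perpendicular before)
        (distinct-neighbours moves (Square.dc after) (P-distinct λ ()))
        (distinct-neighbours moves (step-back (Square.dc before)) (P-distinct (lowerTooth≢bottom _ _)))
        (distinct-neighbours moves (step-back (Square.bc before)) (P-distinct λ ()))

    teeth-collide : ∀ i → lookup A i ≡ true → lookup B i ≡ true → ⊥
    teeth-collide i i∈A i∈B = P-distinct (λ ()) (begin
      P (upperTooth i)          ≡⟨ upper-tooth i i∈A ⟩
      P h ⊕ opposite v          ≡⟨ cong (_⊕ opposite v) (upper-above-lower c) ⟩
      P g ⊕ v ⊕ v ⊕ opposite v  ≡⟨ ⊕-opposite (P g ⊕ v) v ⟩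
      P g ⊕ v                   ≡⟨ lower-tooth i i∈B ⟨
      P (lowerTooth i)          ∎)
      where
      open ≡-Reasoning
      c : Fin (3 ℕ.+ N)
      c = suc (suc (inject₁ i))
      h g : Vertex
      h = top (suc c) 0F
      g = bottom c 1F

  grid⇔disjoint : ∀ A B → GridClass (Γ A B) ⇔ Empty (A ∩ B)
  grid⇔disjoint A B = mk⇔
    (λ grid (i , i∈A∩B) → let i∈A , i∈B = x∈p∩q⁻ A B i∈A∩B in
       Rigidity.teeth-collide grid i ([]=⇒lookup i∈A) ([]=⇒lookup i∈B))
    grid-drawing

  order≤24N : 1 ℕ.≤ N → order ℕ.^ 1 ℕ.≤ 24 ℕ.^ 1 ℕ.* N
  order≤24N 1≤N = begin
    order ℕ.^ 1           ≡⟨ order-formula N ⟩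
    18 ℕ.+ 6 ℕ.* N        ≤⟨ ℕP.+-monoˡ-≤ (6 ℕ.* N) (ℕP.*-monoʳ-≤ 18 1≤N) ⟩
    18 ℕ.* N ℕ.+ 6 ℕ.* N  ≡⟨ ℕP.*-distribʳ-+ N 18 6 ⟨
    24 ℕ.^ 1 ℕ.* N        ∎
    where
    open ℕP.≤-Reasoning
    order-formula : ∀ N → (2 ℕ.+ ((5 ℕ.* 2 ℕ.+ ((2 ℕ.+ N) ℕ.* 2 ℕ.+ N)) ℕ.+ ((1 ℕ.+ N) ℕ.* 2 ℕ.+ N)))
                          ℕ.* 1 ≡ 18 ℕ.+ 6 ℕ.* N
    order-formula = ℕ-Solver.solve-∀

theorem5p5 : DisjExpr 6 1 GridClass
theorem5p5 = 24 , s≤s z≤n , λ N 1≤N → let open Construction N in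
  2 , L , R ,
  (λ A B → Edges.Γ-connected A B , (order , Vertex-atMost , order≤24N 1≤N) ,
           NS-atMost , grid⇔disjoint A B) ,
  NS-iso
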